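{- Let $2\le j\le n$. If no remaining sample lies in $\{SA[j-1]-s,\dots,SA[j-1]-1\}$, then no removed sample lies between $SA[j-1]-1$ and the largest remaining sample preceding $SA[j-1]-1$.
   Context: $T[1..n]$ is a text with suffix array $SA$ and Burrows–Wheeler transform $BWT[i]=T[SA[i]-1]$ ($BWT[i]=T[n]$ if $SA[i]=1$); $r$ is the number of maximal runs of equal letters in $BWT$. For each run, its sample is the text position $SA[i]-1$ (taken as $n$ if $SA[i]=1$) where $i$ is the last position of the run. Let $l_1<\dots<l_r$ be these samples. Subsampling with integer parameter $s\ge1$: for $i=2,\dots,r-1$ in this order, remove $l_i$ if $l_{i+1}-l'\le s$, where $l'$ is the largest not-removed sample among $l_1,\dots,l_{i-1}$. Samples not removed are remaining samples; the others are removed samples. -}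

module Defs where

open import Data.Nat using (ℕ; zero; suc; _+_; _∸_; _≤_; _<_; _≤?_)
open import Data.List using (List; []; _∷_; map; upTo)
open import Data.List.Membership.Propositional using (_∈_)
open import Data.List.Relation.Unary.Linked using (Linked)
open import Data.List.Relation.Binary.Lex.Strict using (Lex-<)
open import Data.Product using (_×_; ∃)
open import Data.Sum using (_⊎_)
open import Data.Empty using (⊥)
open import Relation.Binary.PropositionalEquality using (_≡_; _≢_)
open import Relation.Nullary using (yes; no)
open import Function.Bundles using (_⇔_)

-- Conventions: the text T[1..n] is a function T : ℕ → ℕ (alphabet ℕ, ordered by
-- the usual order) of which only positions 1..n are used.  Arrays (SA) are
-- functions ℕ → ℕ of which only indices 1..n are used.

suffix : (ℕ → ℕ) → ℕ → ℕ → List ℕ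
suffix T n i = map (λ k → T (i + k)) (upTo (suc n ∸ i))

_<ₗ_ : List ℕ → List ℕ → Set
_<ₗ_ = Lex-< _≡_ _<_

-- SA is the suffix array of T[1..n]: SA[1..n] ⊆ [1..n] and the suffixes
-- T[SA[1]..n] < T[SA[2]..n] < ... < T[SA[n]..n] strictly (hence SA is a permutation).
record IsSuffixArray (n : ℕ) (T : ℕ → ℕ) (SA : ℕ → ℕ) : Set where
  field
    inRange : ∀ i → 1 ≤ i → i ≤ n → 1 ≤ SA i × SA i ≤ n
    sorted  : ∀ i → 1 ≤ i → i < n → suffix T n (SA i) <ₗ suffix T n (SA (suc i))

bwtOf : ℕ → (ℕ → ℕ) → ℕ → ℕ
bwtOf n T zero = T n
bwtOf n T (suc zero) = T n
bwtOf n T (suc (suc k)) = T (suc k)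

BWT : ℕ → (ℕ → ℕ) → (ℕ → ℕ) → ℕ → ℕ
BWT n T SA i = bwtOf n T (SA i)

samplePos : ℕ → ℕ → ℕ
samplePos n zero = n
samplePos n (suc zero) = n
samplePos n (suc (suc k)) = suc k

RunEnd : ℕ → (ℕ → ℕ) → (ℕ → ℕ) → ℕ → Set
RunEnd n T SA i = i ≡ n ⊎ BWT n T SA i ≢ BWT n T SA (suc i)

IsSample : ℕ → (ℕ → ℕ) → (ℕ → ℕ) → ℕ → Set
IsSample n T SA x =
  ∃ λ i → 1 ≤ i × i ≤ n × RunEnd n T SA i × x ≡ samplePos n (SA i)

SortedSamples : ℕ → (ℕ → ℕ) → (ℕ → ℕ) → List ℕ → Set
SortedSamples n T SA L = Linked _<_ L × (∀ x → (x ∈ L) ⇔ IsSample n T SA x)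

-- Subsampling.  subsampleFrom s l' x ys processes l_i = x and the rest
-- ys = l_{i+1}, ..., l_r, where l' is the largest not-removed sample among
-- l_1..l_{i-1}; it returns the remaining samples among l_i, ..., l_r.
-- l_i (i < r) is removed iff l_{i+1} - l' ≤ s; l_r is never removed.
subsampleFrom : ℕ → ℕ → ℕ → List ℕ → List ℕ
subsampleFrom s l' x [] = x ∷ []
subsampleFrom s l' x (y ∷ ys) with y ∸ l' ≤? s
... | yes _ = subsampleFrom s l' y ys
... | no _  = x ∷ subsampleFrom s x y ys

remaining : ℕ → List ℕ → List ℕ
remaining s [] = []
remaining s (x ∷ []) = x ∷ []
remaining s (x ∷ y ∷ ys) = x ∷ subsampleFrom s x y ys

Remaining : ℕ → List ℕ → ℕ → Set
Remaining s L x = x ∈ remaining s L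

Removed : ℕ → List ℕ → ℕ → Set
Removed s L x = x ∈ L × (x ∈ remaining s L → ⊥)

-- A removed sample z always lies strictly between two remaining samples a < z < y
-- with y ≤ a + s: the algorithm drops l_i only when l_{i+1} is within s of the last
-- kept sample a, and the chain of drops that follows ends at a kept sample still
-- within s of a.  If moreover z lies between l′ and SA[j-1]-1, then a ≤ l′ by
-- maximality of l′, so y ≤ l′ + s, which is below SA[j-1] because l′ avoids the
-- window; and y > l′ forces y ≥ SA[j-1]-1, so y is a remaining sample in the window.
module Submission where

open import Defs
open import Data.Nat using (ℕ; _+_; _∸_; _≤_; _<_; _≤?_)
open import Data.Nat.Properties
open import Data.Product using (_×_; _,_; ∃)
open import Data.List using (List; []; _∷_)
open import Data.List.Relation.Unary.Any using (here; there)
open import Data.List.Membership.Propositional using (_∈_; _∉_)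
open import Data.List.Relation.Unary.Linked as Linked using (Linked; _∷_)
open import Relation.Binary.PropositionalEquality using (refl; subst)
open import Relation.Nullary using (¬_; yes; no; contradiction)
open import Function using (_∘_)

record InShortGap (s : ℕ) (R : List ℕ) (z : ℕ) : Set where
  constructor gap
  field
    {lower upper}  : ℕ
    lower∈R        : lower ∈ R
    upper∈R        : upper ∈ R
    lower<z        : lower < z
    z<upper        : z < upper
    upper≤lower+s  : upper ≤ lower + s

InShortGap-mono : ∀ {s R R′ z} → (∀ {w} → w ∈ R → w ∈ R′) →
                  InShortGap s R z → InShortGap s R′ z
InShortGap-mono R⊆R′ (gap a∈ y∈ a<z z<y y≤a+s) = gap (R⊆R′ a∈) (R⊆R′ y∈) a<z z<y y≤a+s

Linked-skip : ∀ {a x y ys} → Linked _<_ (a ∷ x ∷ y ∷ ys) → Linked _<_ (a ∷ y ∷ ys)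
Linked-skip (a<x ∷ x<y ∷ ys) = <-trans a<x x<y ∷ ys

subsampleFrom-keeps-close : ∀ s l′ x ys → Linked _<_ (x ∷ ys) → x ∸ l′ ≤ s →
  ∃ λ w → w ∈ subsampleFrom s l′ x ys × x ≤ w × w ∸ l′ ≤ s
subsampleFrom-keeps-close s l′ x []       _ close = x , here refl , ≤-refl , close
subsampleFrom-keeps-close s l′ x (y ∷ ys) x<y∷ys close with y ∸ l′ ≤? s
... | no _ = x , here refl , ≤-refl , close
... | yes y-close
  with w , w∈ , y≤w , w-close ← subsampleFrom-keeps-close s l′ y ys (Linked.tail x<y∷ys) y-close
  = w , w∈ , ≤-trans (<⇒≤ (Linked.head x<y∷ys)) y≤w , w-close

subsampleFrom-removed-in-short-gap : ∀ s l′ x ys z → Linked _<_ (l′ ∷ x ∷ ys) →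
  z ∈ x ∷ ys → z ∉ subsampleFrom s l′ x ys →
  InShortGap s (l′ ∷ subsampleFrom s l′ x ys) z
subsampleFrom-removed-in-short-gap s l′ x (y ∷ ys) z increasing z∈ z∉ with y ∸ l′ ≤? s | z∈
... | yes y-close | here refl
  with w , w∈ , y≤w , w-close ← subsampleFrom-keeps-close s l′ y ys
                                  (Linked.tail (Linked.tail increasing)) y-close
  = gap (here refl) (there w∈) (Linked.head increasing)
        (<-≤-trans (Linked.head (Linked.tail increasing)) y≤w)
        (≤-trans (m≤n+m∸n w l′) (+-monoʳ-≤ l′ w-close))
... | yes _ | there z∈ys =
  subsampleFrom-removed-in-short-gap s l′ y ys z (Linked-skip increasing) z∈ys z∉
... | no _ | here refl = contradiction (here refl) z∉
... | no _ | there z∈ys =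
  InShortGap-mono there
    (subsampleFrom-removed-in-short-gap s x y ys z (Linked.tail increasing) z∈ys (z∉ ∘ there))
subsampleFrom-removed-in-short-gap s l′ x [] z _ z∈ z∉ = contradiction z∈ z∉

removed-in-short-gap : ∀ s L z → Linked _<_ L → Removed s L z → InShortGap s (remaining s L) z
removed-in-short-gap s (a ∷ b ∷ ys) z increasing (there z∈ , z∉) =
  subsampleFrom-removed-in-short-gap s a b ys z increasing z∈ (z∉ ∘ there)
removed-in-short-gap s (a ∷ b ∷ ys) z _ (here refl , z∉) = contradiction (here refl) z∉
removed-in-short-gap s (a ∷ []) z _ (z∈ , z∉) = contradiction z∈ z∉

below-window : ∀ {P s x} → ¬ (P ≤ x + s × x + 1 ≤ P) → x < P → x + s < P
below-window {P} {s} {x} outside x<P with P ≤? x + s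
... | no P≰x+s = ≰⇒> P≰x+s
... | yes P≤x+s = contradiction (P≤x+s , subst (_≤ P) (+-comm 1 x) x<P) outside

lemma5p3 : (n : ℕ) (T : ℕ → ℕ) (SA : ℕ → ℕ) (L : List ℕ) (s : ℕ)
    → IsSuffixArray n T SA → SortedSamples n T SA L → 1 ≤ s
    → (j : ℕ) → 2 ≤ j → j ≤ n
    → (∀ x → Remaining s L x → ¬ (SA (j ∸ 1) ≤ x + s × x + 1 ≤ SA (j ∸ 1)))
    → (l′ : ℕ) → Remaining s L l′ → l′ < SA (j ∸ 1) ∸ 1
    → (∀ y → Remaining s L y → y < SA (j ∸ 1) ∸ 1 → y ≤ l′)
    → ∀ x → Removed s L x → ¬ (l′ < x × x < SA (j ∸ 1) ∸ 1)
lemma5p3 n T SA L s _ (increasing , _) 1≤s j _ _ outside l′ l′∈ l′<P-1 l′-max x x-removed (l′<x , x<P-1)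
  with gap {a} {y} a∈ y∈ a<x x<y y≤a+s ← removed-in-short-gap s L x increasing x-removed
  = <-irrefl refl (≤-<-trans P≤y+s y+s<P)
  where
  P = SA (j ∸ 1)
  l′+s<P : l′ + s < P
  l′+s<P = below-window (outside l′ l′∈) (<-≤-trans l′<P-1 (m∸n≤m P 1))
  y<P : y < P
  y<P = ≤-<-trans y≤a+s (≤-<-trans (+-monoˡ-≤ s (l′-max a a∈ (<-trans a<x x<P-1))) l′+s<P)
  y+s<P : y + s < P
  y+s<P = below-window (outside y y∈) y<P
  P-1≤y : P ∸ 1 ≤ y
  P-1≤y = ≮⇒≥ λ y<P-1 → <⇒≱ (<-trans l′<x x<y) (l′-max y y∈ y<P-1)
  P≤y+s : P ≤ y + s
  P≤y+s = ≤-trans (m≤n+m∸n P 1) (subst (1 + (P ∸ 1) ≤_) (+-comm s y) (+-mono-≤ 1≤s P-1≤y))
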